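{- Let $m\ge 1$ and let $G=(V,E)$ be an $m$-partite graph. Then $M(G)$ is the intersection of at most $m$ matroids on $E$.
   Context: Graphs are finite, undirected, without loops or multiple edges. A graph is $m$-partite if its vertex set can be partitioned into $m$ sets $V_1,\dots,V_m$ such that no edge has both endpoints in the same $V_i$. A matroid on a finite set $S$ is a family $\mathcal{M}$ of subsets of $S$ with $\emptyset\in\mathcal{M}$, closed under subsets, such that for every $A\subseteq S$ all maximal members of $\mathcal{M}$ contained in $A$ have the same cardinality. $M(G)$ denotes the family of all matchings of $G$ (sets of pairwise disjoint edges), viewed as a family of subsets of $E$. The intersection of matroids $\mathcal{M}_1,\dots,\mathcal{M}_k$ on $E$ is $\mathcal{M}_1\cap\dots\cap\mathcal{M}_k$. -}

module Defs where

open import Data.Nat using (ℕ; _≤_)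
open import Data.Fin using (Fin)
open import Data.Fin.Subset using (Subset; _∈_; _⊆_; ∣_∣) renaming (⊥ to ∅)
open import Data.Product using (Σ; _×_; _,_)
open import Data.Sum using (_⊎_)
open import Relation.Binary.PropositionalEquality using (_≡_; _≢_)
open import Relation.Nullary using (¬_)

record Graph : Set where
  field
    n     : ℕ
    k     : ℕ
    end₁  : Fin k → Fin n
    end₂  : Fin k → Fin n
    loopless : ∀ e → end₁ e ≢ end₂ e
    -- no multiple edges (edges are unordered pairs of vertices)
    simple : ∀ e f → e ≢ f →
      ¬ ((end₁ e ≡ end₁ f × end₂ e ≡ end₂ f) ⊎ (end₁ e ≡ end₂ f × end₂ e ≡ end₁ f))

open Graph public

Incident : (G : Graph) → Fin (n G) → Fin (k G) → Set
Incident G v e = (v ≡ end₁ G e) ⊎ (v ≡ end₂ G e)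

IsPartite : ℕ → Graph → Set
IsPartite m G = Σ (Fin (n G) → Fin m) λ c → ∀ e → c (end₁ G e) ≢ c (end₂ G e)

IsMatching : (G : Graph) → Subset (k G) → Set
IsMatching G S = ∀ e f → e ∈ S → f ∈ S → e ≢ f →
  ∀ v → Incident G v e → ¬ Incident G v f

Family : ℕ → Set₁
Family k = Subset k → Set

MaximalIn : ∀ {k} → Family k → Subset k → Subset k → Set
MaximalIn 𝓜 A B = 𝓜 B × B ⊆ A × (∀ C → 𝓜 C → C ⊆ A → B ⊆ C → C ⊆ B)

record IsMatroid {k : ℕ} (𝓜 : Family k) : Set where
  field
    empty    : 𝓜 ∅
    downward : ∀ A B → A ⊆ B → 𝓜 B → 𝓜 A
    equicard : ∀ A B₁ B₂ → MaximalIn 𝓜 A B₁ → MaximalIn 𝓜 A B₂ → ∣ B₁ ∣ ≡ ∣ B₂ ∣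

IntersectionOfAtMost : ℕ → ∀ {k} → Family k → Set₁
IntersectionOfAtMost m {k} 𝓕 =
  Σ ℕ λ j → j ≤ m × Σ (Fin j → Family k) λ 𝓜 →
    (∀ i → IsMatroid (𝓜 i)) × (∀ S → (𝓕 S → ∀ i → 𝓜 i S) × ((∀ i → 𝓜 i S) → 𝓕 S))

-- For each class Vᵢ of the partition, call a set of edges i-independent if no
-- two distinct members share an endpoint in Vᵢ.  A set is a matching iff it is
-- i-independent for every i.  Since an edge has at most one endpoint in Vᵢ,
-- "sharing an endpoint in Vᵢ" is a partial equivalence relation on edges, and
-- the i-independent sets are those meeting each of its classes at most once:
-- a partition matroid.  Two maximal such sets inside A meet exactly the classes
-- that A meets, which gives an injection between them in either direction.
module Submission where

open import Defs
open import Data.Nat using (ℕ; _+_; _≥_; _≤_; z≤n; s≤s)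
open import Data.Nat.Properties using (≤-refl; ≤-antisym)
open import Data.Fin using (Fin; zero; suc)
open import Data.Fin.Properties using (any?; suc-injective; 0≢1+n) renaming (_≟_ to _≟ᶠ_)
open import Data.Fin.Subset using (Subset; _∈_; _⊆_; ∣_∣; _-_; _∪_; ⁅_⁆; inside; outside)
open import Data.Fin.Subset.Properties using (_∈?_; ∉⊥; p─⊥≡p; x∈p∧x≢y⇒x∈p-y; x∈p∪q⁻; p⊆p∪q; q⊆p∪q; x∈⁅x⁆; x∈⁅y⁆⇒x≡y)
open import Data.Vec using (_∷_; [])
open import Data.Vec.Base using (here; there)
open import Data.Product using (∃; _×_; _,_; proj₁; proj₂)
open import Data.Sum using (inj₁; inj₂)
open import Data.Empty using (⊥-elim)
open import Function using (_∘_)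
open import Level using (0ℓ)
open import Relation.Nullary using (¬_; Dec; yes; no)
open import Relation.Nullary.Decidable using (_×-dec_; _⊎-dec_)
open import Relation.Binary.Core using (Rel)
open import Relation.Binary.Definitions using (Decidable)
open import Relation.Binary.Structures using (IsPartialEquivalence)
open import Relation.Binary.Construct.Closure.Reflexive using (ReflClosure; refl; [_])
import Relation.Binary.Construct.Closure.Reflexive.Properties as ReflClosure
open import Relation.Binary.PropositionalEquality using (_≡_; _≢_; refl; sym; trans; cong; subst)

∣p∣≡1+∣p-x∣ : ∀ {k} {x : Fin k} {p : Subset k} → x ∈ p → ∣ p ∣ ≡ 1 + ∣ p - x ∣
∣p∣≡1+∣p-x∣ {x = zero}  {inside ∷ p}  here      = cong (1 +_) (cong ∣_∣ (sym (p─⊥≡p p)))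
∣p∣≡1+∣p-x∣ {x = suc x} {inside ∷ p}  (there h) = cong (1 +_) (∣p∣≡1+∣p-x∣ h)
∣p∣≡1+∣p-x∣ {x = suc x} {outside ∷ p} (there h) = ∣p∣≡1+∣p-x∣ h

injectiveOn⇒∣p∣≤∣q∣ : ∀ {k l} (p : Subset k) {q : Subset l} (f : ∀ {x} → x ∈ p → Fin l) →
  (∀ {x} (x∈p : x ∈ p) → f x∈p ∈ q) →
  (∀ {x y} (x∈p : x ∈ p) (y∈p : y ∈ p) → f x∈p ≡ f y∈p → x ≡ y) →
  ∣ p ∣ ≤ ∣ q ∣
injectiveOn⇒∣p∣≤∣q∣ []            f into inj = z≤n
injectiveOn⇒∣p∣≤∣q∣ (outside ∷ p) f into inj =
  injectiveOn⇒∣p∣≤∣q∣ p (f ∘ there) (into ∘ there)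
    (λ x∈p y∈p → suc-injective ∘ inj (there x∈p) (there y∈p))
injectiveOn⇒∣p∣≤∣q∣ (inside ∷ p) {q} f into inj =
  subst (1 + ∣ p ∣ ≤_) (sym (∣p∣≡1+∣p-x∣ (into here)))
    (s≤s (injectiveOn⇒∣p∣≤∣q∣ p (f ∘ there) into-q-fzero
      (λ x∈p y∈p → suc-injective ∘ inj (there x∈p) (there y∈p))))
  where
  into-q-fzero : ∀ {x} (x∈p : x ∈ p) → f (there x∈p) ∈ q - f here
  into-q-fzero x∈p = x∈p∧x≢y⇒x∈p-y (into (there x∈p)) (0≢1+n ∘ sym ∘ inj (there x∈p) here)

module PartitionMatroid {k : ℕ} {_∼_ : Rel (Fin k) 0ℓ} (_∼?_ : Decidable _∼_)
                        (isPER : IsPartialEquivalence _∼_) where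

  open IsPartialEquivalence isPER renaming (sym to ∼-sym; trans to ∼-trans)

  _≃_ : Rel (Fin k) 0ℓ
  _≃_ = ReflClosure _∼_

  ≃-sym : ∀ {e f} → e ≃ f → f ≃ e
  ≃-sym = ReflClosure.sym ∼-sym

  ≃-trans : ∀ {e f g} → e ≃ f → f ≃ g → e ≃ g
  ≃-trans = ReflClosure.trans ∼-trans

  PairwiseUnrelated : Family k
  PairwiseUnrelated S = ∀ {e f} → e ∈ S → f ∈ S → e ≢ f → ¬ e ∼ f

  maximal⇒covers : ∀ {A B e} → MaximalIn PairwiseUnrelated A B → e ∈ A →
    ∃ λ f → f ∈ B × e ≃ f
  maximal⇒covers {A} {B} {e} (unrelB , B⊆A , maximal) e∈A with e ∈? B
  ... | yes e∈B = e , e∈B , refl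
  ... | no  e∉B with any? (λ f → (f ∈? B) ×-dec (e ∼? f))
  ...   | yes (f , f∈B , e∼f) = f , f∈B , [ e∼f ]
  ...   | no  ¬covered = ⊥-elim (e∉B (maximal (B ∪ ⁅ e ⁆) unrelB+e B+e⊆A (p⊆p∪q ⁅ e ⁆)
                                           (q⊆p∪q B ⁅ e ⁆ (x∈⁅x⁆ e))))
    where
    unrelB+e : PairwiseUnrelated (B ∪ ⁅ e ⁆)
    unrelB+e x∈ y∈ x≢y with x∈p∪q⁻ B ⁅ e ⁆ x∈ | x∈p∪q⁻ B ⁅ e ⁆ y∈
    ... | inj₁ x∈B | inj₁ y∈B = unrelB x∈B y∈B x≢y
    ... | inj₁ x∈B | inj₂ y∈e rewrite x∈⁅y⁆⇒x≡y e y∈e = λ x∼e → ¬covered (_ , x∈B , ∼-sym x∼e)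
    ... | inj₂ x∈e | inj₁ y∈B rewrite x∈⁅y⁆⇒x≡y e x∈e = λ e∼y → ¬covered (_ , y∈B , e∼y)
    ... | inj₂ x∈e | inj₂ y∈e = ⊥-elim (x≢y (trans (x∈⁅y⁆⇒x≡y e x∈e) (sym (x∈⁅y⁆⇒x≡y e y∈e))))
    B+e⊆A : B ∪ ⁅ e ⁆ ⊆ A
    B+e⊆A x∈ with x∈p∪q⁻ B ⁅ e ⁆ x∈
    ... | inj₁ x∈B = B⊆A x∈B
    ... | inj₂ x∈e rewrite x∈⁅y⁆⇒x≡y e x∈e = e∈A

  pairwiseUnrelated-≃⇒≡ : ∀ {S e f} → PairwiseUnrelated S → e ∈ S → f ∈ S → e ≃ f → e ≡ f
  pairwiseUnrelated-≃⇒≡ unrel e∈S f∈S refl = refl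
  pairwiseUnrelated-≃⇒≡ {e = e} {f} unrel e∈S f∈S [ e∼f ] with e ≟ᶠ f
  ... | yes e≡f = e≡f
  ... | no  e≢f = ⊥-elim (unrel e∈S f∈S e≢f e∼f)

  maximal⇒∣≤∣ : ∀ {A B₁ B₂} → MaximalIn PairwiseUnrelated A B₁ → MaximalIn PairwiseUnrelated A B₂ →
    ∣ B₁ ∣ ≤ ∣ B₂ ∣
  maximal⇒∣≤∣ {B₁ = B₁} {B₂} (unrel₁ , B₁⊆A , _) max₂ =
    injectiveOn⇒∣p∣≤∣q∣ B₁ (proj₁ ∘ cover) (proj₁ ∘ proj₂ ∘ cover) cover-injective
    where
    cover : ∀ {e} → e ∈ B₁ → ∃ λ f → f ∈ B₂ × e ≃ f
    cover = maximal⇒covers max₂ ∘ B₁⊆A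

    cover-injective : ∀ {x y} (x∈ : x ∈ B₁) (y∈ : y ∈ B₁) → proj₁ (cover x∈) ≡ proj₁ (cover y∈) → x ≡ y
    cover-injective x∈ y∈ same = pairwiseUnrelated-≃⇒≡ unrel₁ x∈ y∈
      (≃-trans (subst (_ ≃_) same (proj₂ (proj₂ (cover x∈)))) (≃-sym (proj₂ (proj₂ (cover y∈)))))

  pairwiseUnrelated-isMatroid : IsMatroid PairwiseUnrelated
  pairwiseUnrelated-isMatroid = record
    { empty    = λ e∈∅ → ⊥-elim (∉⊥ e∈∅)
    ; downward = λ A B A⊆B unrelB e∈A f∈A → unrelB (A⊆B e∈A) (A⊆B f∈A)
    ; equicard = λ A B₁ B₂ max₁ max₂ → ≤-antisym (maximal⇒∣≤∣ max₁ max₂) (maximal⇒∣≤∣ max₂ max₁)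
    }

module ClassMatroids {m : ℕ} (G : Graph) (class : Fin (n G) → Fin m)
         (proper : ∀ e → class (end₁ G e) ≢ class (end₂ G e)) where

  SharesEndpointIn : Fin m → Rel (Fin (k G)) 0ℓ
  SharesEndpointIn i e f = ∃ λ v → class v ≡ i × Incident G v e × Incident G v f

  incident? : ∀ v e → Dec (Incident G v e)
  incident? v e = (v ≟ᶠ end₁ G e) ⊎-dec (v ≟ᶠ end₂ G e)

  sharesEndpointIn? : ∀ i → Decidable (SharesEndpointIn i)
  sharesEndpointIn? i e f = any? (λ v → (class v ≟ᶠ i) ×-dec (incident? v e ×-dec incident? v f))

  endpoints-sameClass⇒≡ : ∀ {v w e} → class v ≡ class w → Incident G v e → Incident G w e → v ≡ w
  endpoints-sameClass⇒≡         _         (inj₁ refl) (inj₁ refl) = refl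
  endpoints-sameClass⇒≡         _         (inj₂ refl) (inj₂ refl) = refl
  endpoints-sameClass⇒≡ {e = e} sameClass (inj₁ refl) (inj₂ refl) = ⊥-elim (proper e sameClass)
  endpoints-sameClass⇒≡ {e = e} sameClass (inj₂ refl) (inj₁ refl) = ⊥-elim (proper e (sym sameClass))

  sharesEndpointIn-isPER : ∀ i → IsPartialEquivalence (SharesEndpointIn i)
  sharesEndpointIn-isPER i = record
    { sym   = λ (v , v∈Vᵢ , v∈e , v∈f) → v , v∈Vᵢ , v∈f , v∈e
    ; trans = λ (v , v∈Vᵢ , v∈e , v∈f) (w , w∈Vᵢ , w∈f , w∈g) →
        v , v∈Vᵢ , v∈e ,
        subst (λ u → Incident G u _) (sym (endpoints-sameClass⇒≡ (trans v∈Vᵢ (sym w∈Vᵢ)) v∈f w∈f)) w∈g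
    }

  module Independent (i : Fin m) = PartitionMatroid (sharesEndpointIn? i) (sharesEndpointIn-isPER i)

  isMatching⇒independent : ∀ {S} → IsMatching G S → ∀ i → Independent.PairwiseUnrelated i S
  isMatching⇒independent matching i e∈S f∈S e≢f (v , _ , v∈e , v∈f) = matching _ _ e∈S f∈S e≢f v v∈e v∈f

  independent⇒isMatching : ∀ {S} → (∀ i → Independent.PairwiseUnrelated i S) → IsMatching G S
  independent⇒isMatching indep e f e∈S f∈S e≢f v v∈e v∈f = indep (class v) e∈S f∈S e≢f (v , refl , v∈e , v∈f)

theorem1 : (m : ℕ) → m ≥ 1 → (G : Graph) → IsPartite m G →
    IntersectionOfAtMost m (IsMatching G)
theorem1 m _ G (class , proper) =
  m , ≤-refl , Independent.PairwiseUnrelated , Independent.pairwiseUnrelated-isMatroid ,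
  λ S → isMatching⇒independent , independent⇒isMatching
  where open ClassMatroids G class proper
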